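{- Let $G$ be a tree on $n \geq 2$ vertices, and let $z$ be a leaf of $G$ with unique neighbor $y$. Then $$J(z) = J(y) + 4(n^2-3n+2).$$
   Context: For a connected graph $G=(V,E)$ and simple random walk on $G$ (each step moves to a uniformly random neighbor), $H(u,v)$ is the expected number of steps for the walk from $u$ to reach $v$, with $H(u,u)=0$. The joining time to $v$ is $J(v)=\sum_{u\in V}\deg(u)H(u,v)$. -}

module Defs where

open import Data.Nat using (ℕ; zero; suc)
open import Data.Bool using (Bool; true; false; if_then_else_)
open import Data.Fin using (Fin; zero; suc; inject₁; fromℕ)
open import Data.Integer using (+_)
open import Data.Rational using (ℚ; _/_; _+_; _*_; 0ℚ)
open import Data.Empty using (⊥)
open import Relation.Binary.PropositionalEquality using (_≡_; _≢_)
open import Function.Definitions using (Injective)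

record SimpleGraph (n : ℕ) : Set where
  field
    adj    : Fin n → Fin n → Bool
    sym    : ∀ u v → adj u v ≡ adj v u
    irrefl : ∀ u → adj u u ≡ false
open SimpleGraph public

sumℕ : ∀ {n} → (Fin n → ℕ) → ℕ
sumℕ {zero}  f = 0
sumℕ {suc n} f = f zero Data.Nat.+ sumℕ (λ i → f (suc i))

sumℚ : ∀ {n} → (Fin n → ℚ) → ℚ
sumℚ {zero}  f = 0ℚ
sumℚ {suc n} f = f zero + sumℚ (λ i → f (suc i))

ℕ→ℚ : ℕ → ℚ
ℕ→ℚ k = (+ k) / 1

deg : ∀ {n} → SimpleGraph n → Fin n → ℕ
deg G u = sumℕ (λ v → if adj G u v then 1 else 0)

data Walk {n : ℕ} (G : SimpleGraph n) : Fin n → Fin n → Set where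
  here : ∀ {u} → Walk G u u
  step : ∀ {u w v} → adj G u w ≡ true → Walk G w v → Walk G u v

Connected : ∀ {n} → SimpleGraph n → Set
Connected G = ∀ u v → Walk G u v

IsCycle : ∀ {n} → SimpleGraph n → (k : ℕ) → (Fin (suc (suc (suc k))) → Fin n) → Set
IsCycle G k c =
  Injective _≡_ _≡_ c
  × ((i : Fin (suc (suc k))) → adj G (c (inject₁ i)) (c (suc i)) ≡ true)
  × adj G (c (fromℕ (suc (suc k)))) (c zero) ≡ true
  where open import Data.Product using (_×_)

Acyclic : ∀ {n} → SimpleGraph n → Set
Acyclic G = ∀ k c → IsCycle G k c → ⊥

IsTree : ∀ {n} → SimpleGraph n → Set
IsTree G = Connected G × Acyclic G
  where open import Data.Product using (_×_)

-- H is the hitting-time function of simple random walk on G: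
-- H(v,v) = 0, and for u ≠ v the first-step equation
--   H(u,v) = 1 + (1/deg u) Σ_{w ~ u} H(w,v),
-- written multiplied through by deg u (deg u ≥ 1 in the relevant graphs).
IsHittingTime : ∀ {n} → SimpleGraph n → (Fin n → Fin n → ℚ) → Set
IsHittingTime {n} G H =
  (∀ v → H v v ≡ 0ℚ)
  × (∀ u v → u ≢ v →
       ℕ→ℚ (deg G u) * H u v
         ≡ ℕ→ℚ (deg G u) + sumℚ (λ w → if adj G u w then H w v else 0ℚ))
  where open import Data.Product using (_×_)

J : ∀ {n} → SimpleGraph n → (Fin n → Fin n → ℚ) → Fin n → ℚ
J G H v = sumℚ (λ u → ℕ→ℚ (deg G u) * H u v)

{-# OPTIONS --safe #-}

-- Since z is a leaf, a walk from u ≠ z can only reach z through y. In terms of the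
-- first-step equations: H(u,z) − H(u,y), set to H(y,z) at z, is harmonic away from y,
-- hence constant by the maximum principle, so H(u,z) = H(u,y) + H(y,z) for u ≠ z.
-- Summing the first-step equations for the target z gives H(y,z) = Σ deg − 1, and for a
-- tree Σ deg = 2(n − 1), by deleting leaves one at a time (an acyclic graph with an edge
-- has a leaf, since otherwise a walk could go on forever without turning back). Then
-- J(z) − J(y) = H(y,z) Σ deg − Σ deg = (2n − 2)(2n − 4) = 4(n² − 3n + 2).
module Submission where

open import Defs
open import Data.Nat using (ℕ; _≤_)
open import Data.Bool using (true)
open import Data.Fin using (Fin)
open import Data.Rational using (ℚ; _+_; _*_; _-_)
open import Relation.Binary.PropositionalEquality using (_≡_)

open import Algebra.Bundles using (CommutativeMonoid; CommutativeRing)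
import Algebra.Properties.CommutativeMonoid.Sum as MonoidSum
import Algebra.Properties.CommutativeSemigroup as CommutativeSemigroupProperties
import Algebra.Properties.Group as GroupProperties
import Algebra.Properties.Semiring.Sum as SemiringSum
open import Data.Bool using (Bool; false; not; _∧_; if_then_else_)
open import Data.Bool.Properties using (∧-comm; ∧-zeroʳ; ∧-conicalˡ; ∧-conicalʳ; ¬-not) renaming (_≟_ to _≟ᵇ_)
open import Data.Fin using (zero; suc; toℕ; fromℕ; fromℕ<; inject₁; punchIn; _≟_)
open import Data.Fin.Properties
  using (any?; pigeonhole; punchInᵢ≢i; toℕ<n; toℕ-fromℕ; toℕ-fromℕ<; toℕ-inject₁; toℕ-injective)
import Data.Integer as ℤ
import Data.Integer.Properties as ℤP
open import Data.List using (allFin)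
open import Data.List.Membership.Propositional.Properties using (∈-allFin)
open import Data.List.Relation.Unary.All using (lookup)
open import Data.Nat as ℕ using (zero; suc; _<_)
import Data.Nat.Coprimality as Coprime
import Data.Nat.Properties as ℕP
open import Data.Nat.Tactic.RingSolver using (solve-∀)
open import Data.Product using (∃; ∃₂; _×_; _,_; proj₁; proj₂)
open import Data.Rational using (mkℚ; _/_; 0ℚ; 1ℚ; -_) renaming (_≤_ to _≤ℚ_; _<_ to _<ℚ_)
import Data.Rational.Properties as ℚP
open import Data.Sum using (_⊎_; inj₁; inj₂)
open import Function using (_∘_)
open import Relation.Binary.Bundles using (DecTotalOrder)
open import Relation.Binary.Definitions using (tri<; tri≈; tri>)
import Relation.Binary.PropositionalEquality as ≡
open import Relation.Binary.PropositionalEquality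
  using (refl; cong; cong₂; trans; subst; subst₂; _≢_; module ≡-Reasoning)
import Relation.Binary.Reasoning.Setoid as SetoidReasoning
open import Relation.Nullary using (¬_; Dec; yes; no; does; contradiction)
open import Relation.Nullary.Decidable using (dec-true; dec-false)

open import Data.Rational.Solver using (module +-*-Solver)
open +-*-Solver using (solve; _:+_; _:*_; _:-_; _:=_; con)
open import Data.List.Extrema (DecTotalOrder.totalOrder ℚP.≤-decTotalOrder) using (argmax; f[xs]≤f[argmax])


-- Finite sums

module _ {c ℓ} (M : CommutativeMonoid c ℓ) where
  open CommutativeMonoid M
  open MonoidSum M using (sum; sum-remove; sum-cong-≗)
  open CommutativeSemigroupProperties commutativeSemigroup using (xy∙z≈zy∙x)
  open SetoidReasoning setoid

  sum-agree-except : ∀ {n} (x : Fin n) {f g : Fin n → Carrier} →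
                     (∀ u → u ≢ x → f u ≡ g u) → sum f ∙ g x ≈ sum g ∙ f x
  sum-agree-except {suc n} x {f} {g} f≡g = begin
    sum f ∙ g x                        ≈⟨ ∙-congʳ (sum-remove f) ⟩
    (f x ∙ sum (f ∘ punchIn x)) ∙ g x  ≡⟨ cong (λ s → (f x ∙ s) ∙ g x) (sum-cong-≗ f≡g-off-x) ⟩
    (f x ∙ sum (g ∘ punchIn x)) ∙ g x  ≈⟨ xy∙z≈zy∙x (f x) _ (g x) ⟩
    (g x ∙ sum (g ∘ punchIn x)) ∙ f x  ≈⟨ ∙-congʳ (sum-remove g) ⟨
    sum g ∙ f x                        ∎
    where
    f≡g-off-x : ∀ i → f (punchIn x i) ≡ g (punchIn x i)
    f≡g-off-x i = f≡g (punchIn x i) (punchInᵢ≢i x i)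

module ℕΣ = MonoidSum ℕP.+-0-commutativeMonoid
module ℚΣ = SemiringSum (CommutativeRing.semiring ℚP.+-*-commutativeRing)
open GroupProperties ℚP.+-0-group using () renaming (∙-cancelˡ to +-cancelˡ; ⁻¹-involutive to neg-involutive)

sumℕ≡sum : ∀ {n} (f : Fin n → ℕ) → sumℕ f ≡ ℕΣ.sum f
sumℕ≡sum {zero}  f = refl
sumℕ≡sum {suc n} f = cong (f zero ℕ.+_) (sumℕ≡sum (f ∘ suc))

sumℚ≡sum : ∀ {n} (f : Fin n → ℚ) → sumℚ f ≡ ℚΣ.sum f
sumℚ≡sum {zero}  f = refl
sumℚ≡sum {suc n} f = cong (f zero +_) (sumℚ≡sum (f ∘ suc))

sumℕ-cong : ∀ {n} {f g : Fin n → ℕ} → (∀ i → f i ≡ g i) → sumℕ f ≡ sumℕ g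
sumℕ-cong {zero}  f≡g = refl
sumℕ-cong {suc n} f≡g = cong₂ ℕ._+_ (f≡g zero) (sumℕ-cong (f≡g ∘ suc))

sumℕ-zero : ∀ {n} {f : Fin n → ℕ} → (∀ i → f i ≡ 0) → sumℕ f ≡ 0
sumℕ-zero {zero}  f≡0 = refl
sumℕ-zero {suc n} f≡0 = cong₂ ℕ._+_ (f≡0 zero) (sumℕ-zero (f≡0 ∘ suc))

sumℕ-+ : ∀ {n} (f g : Fin n → ℕ) → sumℕ (λ i → f i ℕ.+ g i) ≡ sumℕ f ℕ.+ sumℕ g
sumℕ-+ f g rewrite sumℕ≡sum (λ i → f i ℕ.+ g i) | sumℕ≡sum f | sumℕ≡sum g = ℕΣ.∑-distrib-+ f g

sumℕ-agree-except : ∀ {n} (x : Fin n) {f g : Fin n → ℕ} →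
                    (∀ u → u ≢ x → f u ≡ g u) → sumℕ f ℕ.+ g x ≡ sumℕ g ℕ.+ f x
sumℕ-agree-except x {f} {g} f≡g rewrite sumℕ≡sum f | sumℕ≡sum g =
  sum-agree-except ℕP.+-0-commutativeMonoid x f≡g

sumℚ-cong : ∀ {n} {f g : Fin n → ℚ} → (∀ i → f i ≡ g i) → sumℚ f ≡ sumℚ g
sumℚ-cong {zero}  f≡g = refl
sumℚ-cong {suc n} f≡g = cong₂ _+_ (f≡g zero) (sumℚ-cong (f≡g ∘ suc))

sumℚ-zero : ∀ {n} {f : Fin n → ℚ} → (∀ i → f i ≡ 0ℚ) → sumℚ f ≡ 0ℚ
sumℚ-zero {zero}  f≡0 = refl
sumℚ-zero {suc n} f≡0 = cong₂ _+_ (f≡0 zero) (sumℚ-zero (f≡0 ∘ suc))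

sumℚ-+ : ∀ {n} (f g : Fin n → ℚ) → sumℚ (λ i → f i + g i) ≡ sumℚ f + sumℚ g
sumℚ-+ f g rewrite sumℚ≡sum (λ i → f i + g i) | sumℚ≡sum f | sumℚ≡sum g = ℚΣ.∑-distrib-+ f g

sumℚ-*ˡ : ∀ {n} (c : ℚ) (f : Fin n → ℚ) → sumℚ (λ i → c * f i) ≡ c * sumℚ f
sumℚ-*ˡ c f rewrite sumℚ≡sum (λ i → c * f i) | sumℚ≡sum f = ≡.sym (ℚΣ.*-distribˡ-sum c f)

sumℚ-comm : ∀ {m n} (f : Fin m → Fin n → ℚ) →
            sumℚ (λ i → sumℚ (f i)) ≡ sumℚ (λ j → sumℚ (λ i → f i j))
sumℚ-comm f = begin
  sumℚ (λ i → sumℚ (f i))                   ≡⟨ sumℚ-cong (λ i → sumℚ≡sum (f i)) ⟩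
  sumℚ (λ i → ℚΣ.sum (f i))                 ≡⟨ sumℚ≡sum (λ i → ℚΣ.sum (f i)) ⟩
  ℚΣ.sum (λ i → ℚΣ.sum (f i))               ≡⟨ ℚΣ.∑-comm f ⟩
  ℚΣ.sum (λ j → ℚΣ.sum (λ i → f i j))       ≡⟨ sumℚ≡sum (λ j → ℚΣ.sum (λ i → f i j)) ⟨
  sumℚ (λ j → ℚΣ.sum (λ i → f i j))         ≡⟨ sumℚ-cong (λ j → sumℚ≡sum (λ i → f i j)) ⟨
  sumℚ (λ j → sumℚ (λ i → f i j))           ∎
  where open ≡-Reasoning

sumℚ-agree-except : ∀ {n} (x : Fin n) {f g : Fin n → ℚ} →
                    (∀ u → u ≢ x → f u ≡ g u) → sumℚ f + g x ≡ sumℚ g + f x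
sumℚ-agree-except x {f} {g} f≡g rewrite sumℚ≡sum f | sumℚ≡sum g =
  sum-agree-except ℚP.+-0-commutativeMonoid x f≡g

sumℚ-single : ∀ {n} (x : Fin n) {f : Fin n → ℚ} → (∀ u → u ≢ x → f u ≡ 0ℚ) → sumℚ f ≡ f x
sumℚ-single {n} x {f} f≡0 = begin
  sumℚ f                     ≡⟨ ℚP.+-identityʳ _ ⟨
  sumℚ f + 0ℚ                ≡⟨ sumℚ-agree-except x {g = λ (_ : Fin n) → 0ℚ} f≡0 ⟩
  sumℚ {n} (λ _ → 0ℚ) + f x  ≡⟨ cong (_+ f x) (sumℚ-zero {n} (λ _ → refl)) ⟩
  0ℚ + f x                   ≡⟨ ℚP.+-identityˡ _ ⟩
  f x                        ∎
  where open ≡-Reasoning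

sumℚ-mono-≤ : ∀ {n} {f g : Fin n → ℚ} → (∀ i → f i ≤ℚ g i) → sumℚ f ≤ℚ sumℚ g
sumℚ-mono-≤ {zero}  f≤g = ℚP.≤-refl
sumℚ-mono-≤ {suc n} f≤g = ℚP.+-mono-≤ (f≤g zero) (sumℚ-mono-≤ (f≤g ∘ suc))

sumℚ-mono-< : ∀ {n} {f g : Fin n → ℚ} (b : Fin n) →
              (∀ i → f i ≤ℚ g i) → f b <ℚ g b → sumℚ f <ℚ sumℚ g
sumℚ-mono-< zero    f≤g fb<gb = ℚP.+-mono-<-≤ fb<gb (sumℚ-mono-≤ (f≤g ∘ suc))
sumℚ-mono-< (suc b) f≤g fb<gb = ℚP.+-mono-≤-< (f≤g zero) (sumℚ-mono-< b (f≤g ∘ suc) fb<gb)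

-- (ℤ.+ k) / 1 normalises through gcd k 1, which is stuck for variable k; on the
-- normalised representatives mkℚ (ℤ.+ k) 0, _+_ computes to (+ a * 1 + + b * 1) / 1.
ℕ→ℚ-+ : ∀ a b → ℕ→ℚ (a ℕ.+ b) ≡ ℕ→ℚ a + ℕ→ℚ b
ℕ→ℚ-+ a b = begin
  ℕ→ℚ (a ℕ.+ b)           ≡⟨ cong (_/ 1) (cong₂ ℤ._+_ (ℤP.*-identityʳ (ℤ.+ a)) (ℤP.*-identityʳ (ℤ.+ b))) ⟨
  integer a + integer b   ≡⟨ cong₂ _+_ (ℚP.↥p/↧p≡p (integer a)) (ℚP.↥p/↧p≡p (integer b)) ⟨
  ℕ→ℚ a + ℕ→ℚ b           ∎
  where
  open ≡-Reasoning
  integer : ℕ → ℚ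
  integer k = mkℚ (ℤ.+ k) 0 (Coprime.sym (Coprime.1-coprimeTo k))

ℕ→ℚ-sum : ∀ {n} (f : Fin n → ℕ) → ℕ→ℚ (sumℕ f) ≡ sumℚ (ℕ→ℚ ∘ f)
ℕ→ℚ-sum {zero}  f = refl
ℕ→ℚ-sum {suc n} f = trans (ℕ→ℚ-+ (f zero) _) (cong (ℕ→ℚ (f zero) +_) (ℕ→ℚ-sum (f ∘ suc)))

-- Counting

𝟙 : Bool → ℕ
𝟙 b = if b then 1 else 0

count : ∀ {n} → (Fin n → Bool) → ℕ
count P = sumℕ (λ u → 𝟙 (P u))

_≠ᵇ_ : ∀ {n} → Fin n → Fin n → Bool
u ≠ᵇ x = not (does (u ≟ x))

≠ᵇ-self : ∀ {n} (x : Fin n) → x ≠ᵇ x ≡ false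
≠ᵇ-self x = cong not (dec-true (x ≟ x) refl)

≠ᵇ-other : ∀ {n} {u x : Fin n} → u ≢ x → u ≠ᵇ x ≡ true
≠ᵇ-other {u = u} {x} u≢x = cong not (dec-false (u ≟ x) u≢x)

_∖_ : ∀ {n} → (Fin n → Bool) → Fin n → Fin n → Bool
(P ∖ x) u = u ≠ᵇ x ∧ P u

∖-self : ∀ {n} (P : Fin n → Bool) (x : Fin n) → (P ∖ x) x ≡ false
∖-self P x = cong (_∧ P x) (≠ᵇ-self x)

∖-other : ∀ {n} (P : Fin n → Bool) {u x : Fin n} → u ≢ x → (P ∖ x) u ≡ P u
∖-other P {u} u≢x = cong (_∧ P u) (≠ᵇ-other u≢x)

∖-elim : ∀ {n} {P : Fin n → Bool} {x u : Fin n} → (P ∖ x) u ≡ true → P u ≡ true × u ≢ x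
∖-elim {P = P} {x} {u} P∖x[u] = ∧-conicalʳ _ _ P∖x[u] , u≢x
  where
  u≢x : u ≢ x
  u≢x refl = contradiction (trans (≡.sym (≠ᵇ-self x)) (∧-conicalˡ _ _ P∖x[u])) λ ()

count-agree-except : ∀ {n} (x : Fin n) {P Q : Fin n → Bool} → (∀ u → u ≢ x → P u ≡ Q u) →
                     count P ℕ.+ 𝟙 (Q x) ≡ count Q ℕ.+ 𝟙 (P x)
count-agree-except x P≡Q = sumℕ-agree-except x (λ u u≢x → cong 𝟙 (P≡Q u u≢x))

count-remove : ∀ {n} (P : Fin n → Bool) {x : Fin n} → P x ≡ true → count P ≡ suc (count (P ∖ x))
count-remove P {x} Px = begin
  count P                        ≡⟨ ℕP.+-identityʳ _ ⟨
  count P ℕ.+ 0                  ≡⟨ cong (λ b → count P ℕ.+ 𝟙 b) (∖-self P x) ⟨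
  count P ℕ.+ 𝟙 ((P ∖ x) x)      ≡⟨ count-agree-except x (λ u u≢x → ≡.sym (∖-other P u≢x)) ⟩
  count (P ∖ x) ℕ.+ 𝟙 (P x)      ≡⟨ cong (λ b → count (P ∖ x) ℕ.+ 𝟙 b) Px ⟩
  count (P ∖ x) ℕ.+ 1            ≡⟨ ℕP.+-comm _ 1 ⟩
  suc (count (P ∖ x))            ∎
  where open ≡-Reasoning

count-none : ∀ {n} {P : Fin n → Bool} → (∀ u → P u ≡ false) → count P ≡ 0
count-none none = sumℕ-zero (λ u → cong 𝟙 (none u))

count≢0⇒∃ : ∀ {n} (P : Fin n → Bool) → count P ≢ 0 → ∃ λ u → P u ≡ true
count≢0⇒∃ P count≢0 with any? (λ u → P u ≟ᵇ true)
... | yes found = found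
... | no none   = contradiction (count-none (λ u → ¬-not (λ Pu → none (u , Pu)))) count≢0

count≡1⇒unique : ∀ {n} (P : Fin n → Bool) {a b : Fin n} →
                 count P ≡ 1 → P a ≡ true → P b ≡ true → a ≡ b
count≡1⇒unique P {a} {b} count≡1 Pa Pb with b ≟ a
... | yes b≡a = ≡.sym b≡a
... | no b≢a  = contradiction (trans (≡.sym P∖a-nonempty) P∖a-empty) ℕP.1+n≢0
  where
  P∖a-empty : count (P ∖ a) ≡ 0
  P∖a-empty = ℕP.suc-injective (trans (≡.sym (count-remove P Pa)) count≡1)
  P∖a-nonempty : count (P ∖ a) ≡ suc (count ((P ∖ a) ∖ b))
  P∖a-nonempty = count-remove (P ∖ a) (trans (∖-other P b≢a) Pb)

count-avoid : ∀ {n} (P : Fin n → Bool) {p : Fin n} → P p ≡ true → count P ≢ 1 →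
              ∀ q → ∃ λ c → P c ≡ true × c ≢ q
count-avoid P {p} Pp count≢1 q with p ≟ q
... | no p≢q   = p , Pp , p≢q
... | yes refl with count≢0⇒∃ (P ∖ p) (λ e → count≢1 (trans (count-remove P Pp) (cong suc e)))
...   | c , P∖p[c] = c , ∖-elim {P = P} P∖p[c]

count-all : ∀ n → count {n} (λ _ → true) ≡ n
count-all zero    = refl
count-all (suc n) = cong suc (count-all n)

leaf-unique : ∀ {n} (K : SimpleGraph n) {x a b} →
              deg K x ≡ 1 → adj K x a ≡ true → adj K x b ≡ true → a ≡ b
leaf-unique K {x} leaf = count≡1⇒unique (adj K x) leaf

-- Deleting a vertex

infixl 6 _─_
-- Only the edges at x are removed; x stays as an isolated vertex of the same Fin n.
_─_ : ∀ {n} → SimpleGraph n → Fin n → SimpleGraph n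
K ─ x = record
  { adj    = λ u w → (u ≠ᵇ x ∧ w ≠ᵇ x) ∧ adj K u w
  ; sym    = λ u w → cong₂ _∧_ (∧-comm (u ≠ᵇ x) (w ≠ᵇ x)) (sym K u w)
  ; irrefl = λ u → trans (cong (_ ∧_) (irrefl K u)) (∧-zeroʳ _)
  }

module _ {n} (K : SimpleGraph n) (x : Fin n) where

  ─-adj⇒adj : ∀ {u w} → adj (K ─ x) u w ≡ true → adj K u w ≡ true
  ─-adj⇒adj = ∧-conicalʳ _ _

  ─-adj-self : ∀ w → adj (K ─ x) x w ≡ false
  ─-adj-self w = cong (λ b → (b ∧ w ≠ᵇ x) ∧ adj K x w) (≠ᵇ-self x)

  ─-adj-other : ∀ {u w} → u ≢ x → w ≢ x → adj (K ─ x) u w ≡ adj K u w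
  ─-adj-other u≢x w≢x = cong₂ (λ a b → (a ∧ b) ∧ adj K _ _) (≠ᵇ-other u≢x) (≠ᵇ-other w≢x)

  deg-─ : ∀ u → u ≢ x → deg K u ≡ deg (K ─ x) u ℕ.+ 𝟙 (adj K u x)
  deg-─ u u≢x = begin
    deg K u                               ≡⟨ ℕP.+-identityʳ _ ⟨
    deg K u ℕ.+ 0                         ≡⟨ cong (λ b → deg K u ℕ.+ 𝟙 b) (trans (sym (K ─ x) u x) (─-adj-self u)) ⟨
    deg K u ℕ.+ 𝟙 (adj (K ─ x) u x)       ≡⟨ count-agree-except x (λ w w≢x → ≡.sym (─-adj-other u≢x w≢x)) ⟩
    deg (K ─ x) u ℕ.+ 𝟙 (adj K u x)       ∎
    where open ≡-Reasoning

  degree-sum-─ : sumℕ (deg K) ≡ sumℕ (deg (K ─ x)) ℕ.+ deg K x ℕ.+ deg K x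
  degree-sum-─ = begin
    sumℕ (deg K)                                                   ≡⟨ ℕP.+-identityʳ _ ⟨
    sumℕ (deg K) ℕ.+ 0                                             ≡⟨ cong (sumℕ (deg K) ℕ.+_) at-x ⟨
    sumℕ (deg K) ℕ.+ (deg (K ─ x) x ℕ.+ 𝟙 (adj K x x))             ≡⟨ sumℕ-agree-except x deg-─ ⟩
    sumℕ (λ u → deg (K ─ x) u ℕ.+ 𝟙 (adj K u x)) ℕ.+ deg K x       ≡⟨ cong (ℕ._+ deg K x) split ⟩
    sumℕ (deg (K ─ x)) ℕ.+ deg K x ℕ.+ deg K x                     ∎
    where
    open ≡-Reasoning
    at-x : deg (K ─ x) x ℕ.+ 𝟙 (adj K x x) ≡ 0
    at-x = cong₂ ℕ._+_ (count-none ─-adj-self) (cong 𝟙 (irrefl K x))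
    split : sumℕ (λ u → deg (K ─ x) u ℕ.+ 𝟙 (adj K u x)) ≡ sumℕ (deg (K ─ x)) ℕ.+ deg K x
    split = trans (sumℕ-+ (deg (K ─ x)) (λ u → 𝟙 (adj K u x)))
                  (cong (sumℕ (deg (K ─ x)) ℕ.+_) (sumℕ-cong (λ u → cong 𝟙 (sym K u x))))

  acyclic-─ : Acyclic K → Acyclic (K ─ x)
  acyclic-─ acyclic k c (injective , edges , closing) =
    acyclic k c (injective , ─-adj⇒adj ∘ edges , ─-adj⇒adj closing)

  leaf-walk-─ : deg K x ≡ 1 → ∀ {u v} → u ≢ x → v ≢ x → Walk K u v → Walk (K ─ x) u v
  leaf-walk-─ leaf u≢x v≢x here = here
  leaf-walk-─ leaf {u} {v} u≢x v≢x (step {w = w} uw walk) with w ≟ x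
  ... | no w≢x   = step (trans (─-adj-other u≢x w≢x) uw) (leaf-walk-─ leaf w≢x v≢x walk)
  ... | yes refl = detour walk
    where
    -- A walk entering the leaf x must leave it back to u; the excursion is cut out.
    detour : Walk K x v → Walk (K ─ x) u v
    detour here = contradiction refl v≢x
    detour (step xc walk′) with leaf-unique K leaf xc (trans (sym K x u) uw)
    ... | refl = leaf-walk-─ leaf u≢x v≢x walk′

-- Non-backtracking walks and leaves

DistinctBelow : ∀ {n} → (ℕ → Fin n) → ℕ → Set
DistinctBelow v j = ∀ {a b} → a < b → b < j → v a ≢ v b

FirstRepetition : ∀ {n} → (ℕ → Fin n) → Set
FirstRepetition v = ∃₂ λ i j → i < j × v i ≡ v j × DistinctBelow v j

distinct-or-repetition : ∀ {n} (v : ℕ → Fin n) j → DistinctBelow v j ⊎ FirstRepetition v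
distinct-or-repetition v zero = inj₁ (λ _ ())
distinct-or-repetition v (suc j) with distinct-or-repetition v j
... | inj₂ repetition = inj₂ repetition
... | inj₁ distinct with any? (λ (t : Fin j) → v (toℕ t) ≟ v j)
...   | yes (t , vt≡vj) = inj₂ (toℕ t , j , toℕ<n t , vt≡vj , distinct)
...   | no fresh        = inj₁ extended
  where
  extended : DistinctBelow v (suc j)
  extended {a} {b} a<b b<1+j with ℕP.m<1+n⇒m<n∨m≡n b<1+j
  ... | inj₁ b<j  = distinct a<b b<j
  ... | inj₂ refl = λ va≡vb → fresh (fromℕ< a<b , trans (cong v (toℕ-fromℕ< a<b)) va≡vb)

first-repetition : ∀ {n} (v : ℕ → Fin n) → FirstRepetition v
first-repetition {n} v with distinct-or-repetition v (suc n)
... | inj₂ repetition = repetition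
... | inj₁ distinct with pigeonhole (ℕP.n<1+n n) (v ∘ toℕ)
...   | s , t , s<t , vs≡vt = contradiction vs≡vt (distinct s<t (toℕ<n t))

m<n⇒∃[o]1+o+m≡n : ∀ {m n} → m < n → ∃ λ o → suc (o ℕ.+ m) ≡ n
m<n⇒∃[o]1+o+m≡n {m} m<n with ℕP.m≤n⇒∃[o]m+o≡n m<n
... | o , 1+m+o≡n = o , trans (cong suc (ℕP.+-comm o m)) 1+m+o≡n

module _ {n} (K : SimpleGraph n) where

  record NonBacktracking (v : ℕ → Fin n) : Set where
    field
      adjacent  : ∀ i → adj K (v i) (v (suc i)) ≡ true
      no-return : ∀ i → v (suc (suc i)) ≢ v i

  closed-nonBacktracking-cycle : ∀ {v} → NonBacktracking v → ∀ i k →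
    v (3 ℕ.+ k ℕ.+ i) ≡ v i → DistinctBelow v (3 ℕ.+ k ℕ.+ i) →
    IsCycle K k (λ s → v (toℕ s ℕ.+ i))
  closed-nonBacktracking-cycle {v} walk i k closes distinct = injective , edges , closing
    where
    open NonBacktracking walk
    injective : ∀ {s t} → v (toℕ s ℕ.+ i) ≡ v (toℕ t ℕ.+ i) → s ≡ t
    injective {s} {t} vs≡vt with ℕP.<-cmp (toℕ s) (toℕ t)
    ... | tri< s<t _ _ = contradiction vs≡vt (distinct (ℕP.+-monoˡ-< i s<t) (ℕP.+-monoˡ-< i (toℕ<n t)))
    ... | tri≈ _ s≡t _ = toℕ-injective s≡t
    ... | tri> _ _ t<s = contradiction (≡.sym vs≡vt) (distinct (ℕP.+-monoˡ-< i t<s) (ℕP.+-monoˡ-< i (toℕ<n s)))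
    edges : ∀ s → adj K (v (toℕ (inject₁ s) ℕ.+ i)) (v (suc (toℕ s ℕ.+ i))) ≡ true
    edges s = subst (λ m → adj K (v (m ℕ.+ i)) (v (suc (toℕ s ℕ.+ i))) ≡ true)
                    (≡.sym (toℕ-inject₁ s)) (adjacent (toℕ s ℕ.+ i))
    closing : adj K (v (toℕ (fromℕ (2 ℕ.+ k)) ℕ.+ i)) (v i) ≡ true
    closing = subst₂ (λ a b → adj K a b ≡ true)
                     (cong (λ m → v (m ℕ.+ i)) (≡.sym (toℕ-fromℕ (2 ℕ.+ k)))) closes
                     (adjacent (2 ℕ.+ k ℕ.+ i))

  -- The first repetition cannot come after one step (no loops) or two (no return),
  -- so it closes a cycle of length at least 3.
  acyclic⇒¬nonBacktracking : Acyclic K → ∀ {v} → ¬ NonBacktracking v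
  acyclic⇒¬nonBacktracking acyclic {v} walk with first-repetition v
  ... | i , j , i<j , vi≡vj , distinct with m<n⇒∃[o]1+o+m≡n i<j
  ... | zero , refl = contradiction (trans (≡.sym (irrefl K (v i))) loop) λ ()
    where
    loop : adj K (v i) (v i) ≡ true
    loop = subst (λ w → adj K (v i) w ≡ true) (≡.sym vi≡vj) (NonBacktracking.adjacent walk i)
  ... | suc zero , refl = NonBacktracking.no-return walk i (≡.sym vi≡vj)
  ... | suc (suc k) , refl =
    acyclic k _ (closed-nonBacktracking-cycle walk i k (≡.sym vi≡vj) distinct)

  record Arc : Set where
    field
      source target : Fin n
      edge          : adj K source target ≡ true

  -- Without a vertex of degree 1, each arc can be continued to a neighbour other than
  -- the one it came from.
  acyclic⇒leaf : Acyclic K → ∀ {a b} → adj K a b ≡ true → ∃ λ x → deg K x ≡ 1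
  acyclic⇒leaf acyclic {a} {b} ab with any? (λ x → deg K x ℕ.≟ 1)
  ... | yes leaf   = leaf
  ... | no no-leaf = contradiction walk (acyclic⇒¬nonBacktracking acyclic)
    where
    open Arc
    onward : ∀ α → ∃ λ c → adj K (target α) c ≡ true × c ≢ source α
    onward α = count-avoid (adj K (target α)) (trans (sym K _ _) (edge α))
                           (λ leaf → no-leaf (target α , leaf)) (source α)
    turn : Arc → Arc
    turn α = record { source = target α ; target = proj₁ (onward α) ; edge = proj₁ (proj₂ (onward α)) }
    arcs : ℕ → Arc
    arcs zero    = record { source = a ; target = b ; edge = ab }
    arcs (suc i) = turn (arcs i)
    walk : NonBacktracking (source ∘ arcs)
    walk = record { adjacent = edge ∘ arcs ; no-return = proj₂ ∘ proj₂ ∘ onward ∘ arcs }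

-- Degree sum of a tree

-- Deleted leaves stay behind as isolated vertices outside S.
record IsTreeOn {n} (K : SimpleGraph n) (S : Fin n → Bool) : Set where
  field
    edges-within : ∀ {u w} → adj K u w ≡ true → S u ≡ true
    connected-on : ∀ {u v} → S u ≡ true → S v ≡ true → Walk K u v
    acyclic      : Acyclic K

module _ {n} {K : SimpleGraph n} {S : Fin n → Bool} (tree : IsTreeOn K S) where
  open IsTreeOn tree

  leaf∈S : ∀ {x} → deg K x ≡ 1 → S x ≡ true
  leaf∈S {x} leaf = edges-within (proj₂ (count≢0⇒∃ (adj K x) (λ e → ℕP.1+n≢0 (trans (≡.sym leaf) e))))

  has-edge : ∀ {k} → count S ≡ suc (suc k) → ∃₂ λ a b → adj K a b ≡ true
  has-edge |S|≡2+k with count≢0⇒∃ S (λ e → ℕP.1+n≢0 (trans (≡.sym |S|≡2+k) e))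
  ... | u , Su with count≢0⇒∃ (S ∖ u) (λ e → ℕP.1+n≢0 (trans (≡.sym (|S∖u|≡1+k)) e))
    where
    |S∖u|≡1+k = ℕP.suc-injective (trans (≡.sym (count-remove S Su)) |S|≡2+k)
  ... | w , S∖u[w] with ∖-elim {P = S} S∖u[w]
  ... | Sw , w≢u = first-edge (connected-on Su Sw) w≢u
    where
    first-edge : ∀ {v} → Walk K u v → v ≢ u → ∃₂ λ a b → adj K a b ≡ true
    first-edge here              v≢u = contradiction refl v≢u
    first-edge (step {w = c} uc _) _ = u , c , uc

  remove-leaf : ∀ {x} → deg K x ≡ 1 → IsTreeOn (K ─ x) (S ∖ x)
  remove-leaf {x} leaf = record
    { edges-within = λ uw → cong₂ _∧_ (∧-conicalˡ _ _ (∧-conicalˡ _ _ uw)) (edges-within (─-adj⇒adj K x uw))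
    ; connected-on = λ su sv → let Su , u≢x = ∖-elim {P = S} su ; Sv , v≢x = ∖-elim {P = S} sv in
                       leaf-walk-─ K x leaf u≢x v≢x (connected-on Su Sv)
    ; acyclic      = acyclic-─ K x acyclic
    }

treeOn-degree-sum : ∀ {n} {K : SimpleGraph n} {S} k → IsTreeOn K S → count S ≡ suc k →
                    sumℕ (deg K) ≡ k ℕ.+ k
treeOn-degree-sum {K = K} {S} zero tree |S|≡1 = sumℕ-zero (λ u → count-none (no-edge u))
  where
  open IsTreeOn tree
  no-edge : ∀ u w → adj K u w ≡ false
  no-edge u w with adj K u w in uw
  ... | false = refl
  ... | true with count≡1⇒unique S |S|≡1 (edges-within uw) (edges-within (trans (sym K w u) uw))
  ...   | refl = contradiction (trans (≡.sym (irrefl K u)) uw) λ ()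
treeOn-degree-sum {K = K} {S} (suc k) tree |S|≡2+k with has-edge tree |S|≡2+k
... | a , b , ab with acyclic⇒leaf K (IsTreeOn.acyclic tree) ab
... | x , leaf = begin
  sumℕ (deg K)                                   ≡⟨ degree-sum-─ K x ⟩
  sumℕ (deg (K ─ x)) ℕ.+ deg K x ℕ.+ deg K x      ≡⟨ cong₂ (λ s d → s ℕ.+ d ℕ.+ d) (treeOn-degree-sum k (remove-leaf tree leaf) |S∖x|≡1+k) leaf ⟩
  k ℕ.+ k ℕ.+ 1 ℕ.+ 1                            ≡⟨ twice-suc k ⟩
  suc k ℕ.+ suc k                                ∎
  where
  open ≡-Reasoning
  |S∖x|≡1+k : count (S ∖ x) ≡ suc k
  |S∖x|≡1+k = ℕP.suc-injective (trans (≡.sym (count-remove S (leaf∈S tree leaf))) |S|≡2+k)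
  twice-suc : ∀ k → k ℕ.+ k ℕ.+ 1 ℕ.+ 1 ≡ suc k ℕ.+ suc k
  twice-suc = solve-∀

tree-degree-sum : ∀ {k} (G : SimpleGraph (suc k)) → IsTree G → sumℕ (deg G) ≡ k ℕ.+ k
tree-degree-sum {k} G (connected , acyclic) = treeOn-degree-sum k spanning (count-all (suc k))
  where
  spanning : IsTreeOn G (λ _ → true)
  spanning = record
    { edges-within = λ _ → refl
    ; connected-on = λ {u} {v} _ _ → connected u v
    ; acyclic      = acyclic
    }

-- Harmonic functions

module _ {n} (K : SimpleGraph n) where

  degℚ : Fin n → ℚ
  degℚ u = ℕ→ℚ (deg K u)

  onNbrs : Fin n → (Fin n → ℚ) → Fin n → ℚ
  onNbrs u f w = if adj K u w then f w else 0ℚ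

  nbrSum : Fin n → (Fin n → ℚ) → ℚ
  nbrSum u f = sumℚ (onNbrs u f)

  nbrSum-cong : ∀ u {f g} → (∀ w → adj K u w ≡ true → f w ≡ g w) → nbrSum u f ≡ nbrSum u g
  nbrSum-cong u {f} {g} f≡g = sumℚ-cong on-neighbours
    where
    on-neighbours : ∀ w → onNbrs u f w ≡ onNbrs u g w
    on-neighbours w with adj K u w in uw
    ... | true  = f≡g w uw
    ... | false = refl

  nbrSum-+ : ∀ u f g → nbrSum u (λ w → f w + g w) ≡ nbrSum u f + nbrSum u g
  nbrSum-+ u f g = trans (sumℚ-cong split) (sumℚ-+ (onNbrs u f) (onNbrs u g))
    where
    split : ∀ w → onNbrs u (λ w → f w + g w) w ≡ onNbrs u f w + onNbrs u g w
    split w with adj K u w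
    ... | true  = refl
    ... | false = refl

  nbrSum-*ˡ : ∀ u c f → nbrSum u (λ w → c * f w) ≡ c * nbrSum u f
  nbrSum-*ˡ u c f = trans (sumℚ-cong scale) (sumℚ-*ˡ c (onNbrs u f))
    where
    scale : ∀ w → onNbrs u (λ w → c * f w) w ≡ c * onNbrs u f w
    scale w with adj K u w
    ... | true  = refl
    ... | false = ≡.sym (ℚP.*-zeroʳ c)

  nbrSum-neg : ∀ u f → nbrSum u (λ w → - f w) ≡ - nbrSum u f
  nbrSum-neg u f = begin
    nbrSum u (λ w → - f w)           ≡⟨ nbrSum-cong u (λ w _ → neg≡-1* (f w)) ⟩
    nbrSum u (λ w → - 1ℚ * f w)      ≡⟨ nbrSum-*ˡ u (- 1ℚ) f ⟩
    - 1ℚ * nbrSum u f                ≡⟨ neg≡-1* (nbrSum u f) ⟨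
    - nbrSum u f                     ∎
    where
    open ≡-Reasoning
    neg≡-1* : ∀ q → - q ≡ - 1ℚ * q
    neg≡-1* q = trans (cong -_ (≡.sym (ℚP.*-identityˡ q))) (ℚP.neg-distribˡ-* 1ℚ q)

  nbrSum-const : ∀ u c → nbrSum u (λ _ → c) ≡ degℚ u * c
  nbrSum-const u c = begin
    nbrSum u (λ _ → c)                 ≡⟨ nbrSum-cong u (λ _ _ → ℚP.*-identityʳ c) ⟨
    nbrSum u (λ _ → c * 1ℚ)            ≡⟨ nbrSum-*ˡ u c (λ _ → 1ℚ) ⟩
    c * nbrSum u (λ _ → 1ℚ)            ≡⟨ cong (c *_) nbrSum-one ⟩
    c * degℚ u                         ≡⟨ ℚP.*-comm c (degℚ u) ⟩
    degℚ u * c                         ∎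
    where
    open ≡-Reasoning
    ℕ→ℚ-𝟙 : ∀ b → (if b then 1ℚ else 0ℚ) ≡ ℕ→ℚ (𝟙 b)
    ℕ→ℚ-𝟙 true  = refl
    ℕ→ℚ-𝟙 false = refl
    nbrSum-one : nbrSum u (λ _ → 1ℚ) ≡ degℚ u
    nbrSum-one = trans (sumℚ-cong (λ w → ℕ→ℚ-𝟙 (adj K u w))) (≡.sym (ℕ→ℚ-sum (λ w → 𝟙 (adj K u w))))

  sum-nbrSum : ∀ f → sumℚ (λ u → nbrSum u f) ≡ sumℚ (λ w → degℚ w * f w)
  sum-nbrSum f = begin
    sumℚ (λ u → nbrSum u f)                            ≡⟨ sumℚ-comm (λ u → onNbrs u f) ⟩
    sumℚ (λ w → sumℚ (λ u → onNbrs u f w))             ≡⟨ sumℚ-cong (λ w → sumℚ-cong (λ u → by-symmetry u w)) ⟩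
    sumℚ (λ w → nbrSum w (λ _ → f w))                  ≡⟨ sumℚ-cong (λ w → nbrSum-const w (f w)) ⟩
    sumℚ (λ w → degℚ w * f w)                          ∎
    where
    open ≡-Reasoning
    by-symmetry : ∀ u w → onNbrs u f w ≡ onNbrs w (λ _ → f w) u
    by-symmetry u w = cong (if_then f w else 0ℚ) (sym K u w)

  HarmonicAwayFrom : Fin n → (Fin n → ℚ) → Set
  HarmonicAwayFrom y h = ∀ u → u ≢ y → degℚ u * h u ≡ nbrSum u h

  module _ {y : Fin n} {h : Fin n → ℚ} (harmonic : HarmonicAwayFrom y h) where

    IsMaximum : Fin n → Set
    IsMaximum a = ∀ w → h w ≤ℚ h a

    -- A neighbour below the maximum would pull the average of the neighbours below h a.
    maximum-spreads : ∀ {a b} → a ≢ y → IsMaximum a → adj K a b ≡ true → h a ≤ℚ h b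
    maximum-spreads {a} {b} a≢y a-max ab =
      ℚP.≮⇒≥ λ hb<ha → ℚP.<-irrefl average (sumℚ-mono-< b below (strictly-below-at-b hb<ha))
      where
      average : nbrSum a h ≡ nbrSum a (λ _ → h a)
      average = trans (≡.sym (harmonic a a≢y)) (≡.sym (nbrSum-const a (h a)))
      below : ∀ w → onNbrs a h w ≤ℚ onNbrs a (λ _ → h a) w
      below w with adj K a w
      ... | true  = a-max w
      ... | false = ℚP.≤-refl
      strictly-below-at-b : h b <ℚ h a → onNbrs a h b <ℚ onNbrs a (λ _ → h a) b
      strictly-below-at-b hb<ha rewrite ab = hb<ha

    maximum-reaches : ∀ {a} → Walk K a y → IsMaximum a → h a ≤ℚ h y
    maximum-reaches here _ = ℚP.≤-refl
    maximum-reaches {a} (step ab walk) a-max with a ≟ y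
    ... | yes refl = ℚP.≤-refl
    ... | no a≢y   = ℚP.≤-trans ha≤hb (maximum-reaches walk (λ w → ℚP.≤-trans (a-max w) ha≤hb))
      where
      ha≤hb = maximum-spreads a≢y a-max ab

    maximum-principle : Connected K → ∀ u → h u ≤ℚ h y
    maximum-principle connected u = ℚP.≤-trans (m-max u) (maximum-reaches (connected m y) m-max)
      where
      m : Fin n
      m = argmax h y (allFin n)
      m-max : IsMaximum m
      m-max w = lookup (f[xs]≤f[argmax] y (allFin n)) (∈-allFin w)

  harmonic-neg : ∀ {y h} → HarmonicAwayFrom y h → HarmonicAwayFrom y (λ u → - h u)
  harmonic-neg {h = h} harmonic u u≢y = begin
    degℚ u * - h u      ≡⟨ ℚP.neg-distribʳ-* (degℚ u) (h u) ⟨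
    - (degℚ u * h u)    ≡⟨ cong -_ (harmonic u u≢y) ⟩
    - nbrSum u h        ≡⟨ nbrSum-neg u h ⟨
    nbrSum u (λ w → - h w) ∎
    where open ≡-Reasoning

  harmonic-constant : Connected K → ∀ {y h} → HarmonicAwayFrom y h → ∀ u → h u ≡ h y
  harmonic-constant connected {y} {h} harmonic u =
    ℚP.≤-antisym (maximum-principle harmonic connected u) hy≤hu
    where
    hy≤hu : h y ≤ℚ h u
    hy≤hu = subst₂ _≤ℚ_ (neg-involutive (h y)) (neg-involutive (h u))
                   (ℚP.neg-antimono-≤ (maximum-principle (harmonic-neg harmonic) connected u))

-- Hitting times

module _ {n} (K : SimpleGraph n) (H : Fin n → Fin n → ℚ) (hitting : IsHittingTime K H) where

  hitting-self : ∀ v → H v v ≡ 0ℚ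
  hitting-self = proj₁ hitting

  Hto : Fin n → Fin n → ℚ
  Hto v u = H u v

  first-step : ∀ u v → u ≢ v → degℚ K u * H u v ≡ degℚ K u + nbrSum K u (Hto v)
  first-step = proj₂ hitting

  degℚ-hitting-self : ∀ v → degℚ K v * H v v ≡ 0ℚ
  degℚ-hitting-self v = trans (cong (degℚ K v *_) (hitting-self v)) (ℚP.*-zeroʳ (degℚ K v))

  -- Summed over all u ≠ v, the neighbour sums of the first-step equations add up to J(v) again.
  hitting-return : ∀ v → degℚ K v + nbrSum K v (Hto v) ≡ sumℚ (degℚ K)
  hitting-return v = +-cancelˡ (J K H v) _ _ (begin
    J K H v + (degℚ K v + nbrSum K v (Hto v))        ≡⟨ sumℚ-agree-except v (λ u u≢v → first-step u v u≢v) ⟩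
    sumℚ (λ u → degℚ K u + nbrSum K u (Hto v)) + degℚ K v * H v v
                                                     ≡⟨ cong₂ _+_ sum-first-steps (degℚ-hitting-self v) ⟩
    sumℚ (degℚ K) + J K H v + 0ℚ                     ≡⟨ ℚP.+-identityʳ _ ⟩
    sumℚ (degℚ K) + J K H v                          ≡⟨ ℚP.+-comm (sumℚ (degℚ K)) (J K H v) ⟩
    J K H v + sumℚ (degℚ K)                          ∎)
    where
    open ≡-Reasoning
    sum-first-steps : sumℚ (λ u → degℚ K u + nbrSum K u (Hto v)) ≡ sumℚ (degℚ K) + J K H v
    sum-first-steps = trans (sumℚ-+ (degℚ K) (λ u → nbrSum K u (Hto v)))
                            (cong (sumℚ (degℚ K) +_) (sum-nbrSum K (Hto v)))

  module _ {z y : Fin n} (leaf : deg K z ≡ 1) (zy : adj K z y ≡ true) where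

    degℚ-leaf : degℚ K z ≡ 1ℚ
    degℚ-leaf = cong ℕ→ℚ leaf

    y≢z : y ≢ z
    y≢z refl = contradiction (trans (≡.sym (irrefl K y)) zy) λ ()

    nbrSum-leaf : ∀ f → nbrSum K z f ≡ f y
    nbrSum-leaf f = trans (sumℚ-single y off-y) (cong (if_then f y else 0ℚ) zy)
      where
      off-y : ∀ w → w ≢ y → onNbrs K z f w ≡ 0ℚ
      off-y w w≢y with adj K z w in zw
      ... | true  = contradiction (leaf-unique K leaf zw zy) w≢y
      ... | false = refl

    hitting-leaf-neighbour : H z y ≡ 1ℚ
    hitting-leaf-neighbour = begin
      H z y                        ≡⟨ ℚP.*-identityˡ _ ⟨
      1ℚ * H z y                   ≡⟨ cong (_* H z y) degℚ-leaf ⟨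
      degℚ K z * H z y             ≡⟨ first-step z y (y≢z ∘ ≡.sym) ⟩
      degℚ K z + nbrSum K z (Hto y) ≡⟨ cong₂ _+_ degℚ-leaf (trans (nbrSum-leaf (Hto y)) (hitting-self y)) ⟩
      1ℚ + 0ℚ                      ≡⟨ ℚP.+-identityʳ 1ℚ ⟩
      1ℚ                           ∎
      where open ≡-Reasoning

    hitting-to-leaf : 1ℚ + H y z ≡ sumℚ (degℚ K)
    hitting-to-leaf = trans (cong₂ _+_ (≡.sym degℚ-leaf) (≡.sym (nbrSum-leaf (Hto z)))) (hitting-return z)

    -- Patched at z so that it is harmonic there as well.
    excess : Fin n → ℚ
    excess u = if does (u ≟ z) then H y z else H u z - H u y

    excess-leaf : excess z ≡ H y z
    excess-leaf = cong (if_then H y z else H z z - H z y) (dec-true (z ≟ z) refl)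

    excess-other : ∀ {u} → u ≢ z → excess u ≡ H u z - H u y
    excess-other {u} u≢z = cong (if_then H y z else H u z - H u y) (dec-false (u ≟ z) u≢z)

    excess-harmonic-leaf : degℚ K z * excess z ≡ nbrSum K z excess
    excess-harmonic-leaf = begin
      degℚ K z * excess z          ≡⟨ cong₂ _*_ degℚ-leaf excess-leaf ⟩
      1ℚ * H y z                   ≡⟨ ℚP.*-identityˡ _ ⟩
      H y z                        ≡⟨ ℚP.+-identityʳ _ ⟨
      H y z - 0ℚ                   ≡⟨ cong (λ t → H y z - t) (hitting-self y) ⟨
      H y z - H y y                ≡⟨ excess-other y≢z ⟨
      excess y                     ≡⟨ nbrSum-leaf excess ⟨
      nbrSum K z excess            ∎
      where open ≡-Reasoning

    excess-harmonic-inner : ∀ {u} → u ≢ y → u ≢ z → degℚ K u * excess u ≡ nbrSum K u excess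
    excess-harmonic-inner {u} u≢y u≢z = begin
      degℚ K u * excess u                                      ≡⟨ cong (degℚ K u *_) (excess-other u≢z) ⟩
      degℚ K u * (H u z - H u y)                               ≡⟨ *-distribˡ-- (degℚ K u) (H u z) (H u y) ⟩
      degℚ K u * H u z - degℚ K u * H u y                      ≡⟨ cong₂ _-_ (first-step u z u≢z) (first-step u y u≢y) ⟩
      (degℚ K u + nbrSum K u (Hto z)) - (degℚ K u + nbrSum K u (Hto y))
                                                               ≡⟨ cancel (degℚ K u) (nbrSum K u (Hto z)) (nbrSum K u (Hto y)) ⟩
      nbrSum K u (Hto z) - nbrSum K u (Hto y)                  ≡⟨ cong (nbrSum K u (Hto z) +_) (nbrSum-neg K u (Hto y)) ⟨
      nbrSum K u (Hto z) + nbrSum K u (λ w → - H w y)          ≡⟨ nbrSum-+ K u (Hto z) (λ w → - H w y) ⟨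
      nbrSum K u (λ w → H w z - H w y)                         ≡⟨ nbrSum-cong K u (λ w uw → ≡.sym (excess-other (w≢z uw))) ⟩
      nbrSum K u excess                                        ∎
      where
      open ≡-Reasoning
      w≢z : ∀ {w} → adj K u w ≡ true → w ≢ z
      w≢z uw refl = u≢y (leaf-unique K leaf (trans (sym K z u) uw) zy)
      *-distribˡ-- : ∀ d a b → d * (a - b) ≡ d * a - d * b
      *-distribˡ-- d a b = trans (ℚP.*-distribˡ-+ d a (- b)) (cong (d * a +_) (≡.sym (ℚP.neg-distribʳ-* d b)))
      cancel : ∀ d a b → (d + a) - (d + b) ≡ a - b
      cancel = solve 3 (λ d a b → (d :+ a) :- (d :+ b) := a :- b) refl

    excess-harmonic : HarmonicAwayFrom K y excess
    excess-harmonic u u≢y = by-cases (u ≟ z)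
      where
      by-cases : Dec (u ≡ z) → degℚ K u * excess u ≡ nbrSum K u excess
      by-cases (yes refl) = excess-harmonic-leaf
      by-cases (no u≢z)   = excess-harmonic-inner u≢y u≢z

    hitting-via-neighbour : Connected K → ∀ u → u ≢ z → H u z ≡ H u y + H y z
    hitting-via-neighbour connected u u≢z = begin
      H u z                         ≡⟨ split (H u z) (H u y) ⟩
      H u y + (H u z - H u y)       ≡⟨ cong (H u y +_) (excess-other u≢z) ⟨
      H u y + excess u              ≡⟨ cong (H u y +_) (harmonic-constant K connected excess-harmonic u) ⟩
      H u y + excess y              ≡⟨ cong (H u y +_) (excess-other y≢z) ⟩
      H u y + (H y z - H y y)       ≡⟨ cong (λ t → H u y + (H y z - t)) (hitting-self y) ⟩
      H u y + (H y z - 0ℚ)          ≡⟨ cong (H u y +_) (ℚP.+-identityʳ (H y z)) ⟩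
      H u y + H y z                 ∎
      where
      open ≡-Reasoning
      split : ∀ a b → a ≡ b + (a - b)
      split = solve 2 (λ a b → a := b :+ (a :- b)) refl

    joining-time-leaf : Connected K → J K H z + sumℚ (degℚ K) ≡ J K H y + H y z * sumℚ (degℚ K)
    joining-time-leaf connected = begin
      J K H z + sumℚ (degℚ K)                  ≡⟨ cong (J K H z +_) (trans (≡.sym hitting-to-leaf) (≡.sym at-z)) ⟩
      J K H z + degℚ K z * (H z y + H y z)      ≡⟨ sumℚ-agree-except z (λ u u≢z → cong (degℚ K u *_) (hitting-via-neighbour connected u u≢z)) ⟩
      sumℚ (λ u → degℚ K u * (H u y + H y z)) + degℚ K z * H z z
                                                ≡⟨ cong₂ _+_ sum-via-y (degℚ-hitting-self z) ⟩
      J K H y + H y z * sumℚ (degℚ K) + 0ℚ      ≡⟨ ℚP.+-identityʳ _ ⟩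
      J K H y + H y z * sumℚ (degℚ K)           ∎
      where
      open ≡-Reasoning
      at-z : degℚ K z * (H z y + H y z) ≡ 1ℚ + H y z
      at-z = trans (cong₂ _*_ degℚ-leaf (cong (_+ H y z) hitting-leaf-neighbour)) (ℚP.*-identityˡ _)
      distrib : ∀ d a c → d * (a + c) ≡ d * a + c * d
      distrib d a c = trans (ℚP.*-distribˡ-+ d a c) (cong (d * a +_) (ℚP.*-comm d c))
      sum-via-y : sumℚ (λ u → degℚ K u * (H u y + H y z)) ≡ J K H y + H y z * sumℚ (degℚ K)
      sum-via-y = begin
        sumℚ (λ u → degℚ K u * (H u y + H y z))                ≡⟨ sumℚ-cong (λ u → distrib (degℚ K u) (H u y) (H y z)) ⟩
        sumℚ (λ u → degℚ K u * H u y + H y z * degℚ K u)       ≡⟨ sumℚ-+ (λ u → degℚ K u * H u y) (λ u → H y z * degℚ K u) ⟩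
        J K H y + sumℚ (λ u → H y z * degℚ K u)                ≡⟨ cong (J K H y +_) (sumℚ-*ˡ (H y z) (degℚ K)) ⟩
        J K H y + H y z * sumℚ (degℚ K)                        ∎

joining-arithmetic : ∀ {Jz Jy c D m : ℚ} → D ≡ m + m → 1ℚ + c ≡ D → Jz + D ≡ Jy + c * D →
  Jz ≡ Jy + ℕ→ℚ 4 * ((1ℚ + m) * (1ℚ + m) - ℕ→ℚ 3 * (1ℚ + m) + ℕ→ℚ 2)
joining-arithmetic {Jz} {Jy} {c} {m = m} refl 1+c≡D joining = begin
  Jz                                  ≡⟨ add-sub Jz (m + m) ⟩
  Jz + (m + m) - (m + m)              ≡⟨ cong (_- (m + m)) joining ⟩
  Jy + c * (m + m) - (m + m)          ≡⟨ cong (λ t → Jy + t * (m + m) - (m + m)) c≡ ⟩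
  Jy + (m + m - 1ℚ) * (m + m) - (m + m) ≡⟨ expand Jy m ⟩
  Jy + ℕ→ℚ 4 * ((1ℚ + m) * (1ℚ + m) - ℕ→ℚ 3 * (1ℚ + m) + ℕ→ℚ 2) ∎
  where
  open ≡-Reasoning
  add-sub : ∀ a b → a ≡ a + b - b
  add-sub = solve 2 (λ a b → a := a :+ b :- b) refl
  c≡ : c ≡ m + m - 1ℚ
  c≡ = trans (trans (add-sub c 1ℚ) (cong (_- 1ℚ) (ℚP.+-comm c 1ℚ))) (cong (_- 1ℚ) 1+c≡D)
  expand : ∀ Jy m → Jy + (m + m - 1ℚ) * (m + m) - (m + m) ≡
                    Jy + ℕ→ℚ 4 * ((1ℚ + m) * (1ℚ + m) - ℕ→ℚ 3 * (1ℚ + m) + ℕ→ℚ 2)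
  expand = solve 2 (λ Jy m → Jy :+ (m :+ m :- con 1ℚ) :* (m :+ m) :- (m :+ m) :=
    Jy :+ con (ℕ→ℚ 4) :* ((con 1ℚ :+ m) :* (con 1ℚ :+ m) :- con (ℕ→ℚ 3) :* (con 1ℚ :+ m) :+ con (ℕ→ℚ 2))) refl

lemma3p1 : (n : ℕ) → 2 ≤ n → (G : SimpleGraph n) → IsTree G →
    (z y : Fin n) → deg G z ≡ 1 → adj G z y ≡ true →
    (H : Fin n → Fin n → ℚ) → IsHittingTime G H →
    J G H z ≡ J G H y + ℕ→ℚ 4 * (ℕ→ℚ n * ℕ→ℚ n - ℕ→ℚ 3 * ℕ→ℚ n + ℕ→ℚ 2)
lemma3p1 (suc k) _ G tree@(connected , _) z y leaf zy H hitting =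
  subst (λ N → J G H z ≡ J G H y + ℕ→ℚ 4 * (N * N - ℕ→ℚ 3 * N + ℕ→ℚ 2)) (≡.sym (ℕ→ℚ-+ 1 k))
    (joining-arithmetic {J G H z} {J G H y} {H y z} {m = ℕ→ℚ k}
      degree-sum
      (hitting-to-leaf G H hitting leaf zy)
      (joining-time-leaf G H hitting leaf zy connected))
  where
  degree-sum : sumℚ (degℚ G) ≡ ℕ→ℚ k + ℕ→ℚ k
  degree-sum = trans (≡.sym (ℕ→ℚ-sum (deg G))) (trans (cong ℕ→ℚ (tree-degree-sum G tree)) (ℕ→ℚ-+ k k))
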